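{- Let $w$ be a word, $k$ a positive integer, and $i<j$ indices such that the fragments $w[i..i+2k-1]$ and $w[j..j+2k-1]$ are Abelian squares. If the fragment $w[i+k..j+k-1]$ is uniform, then $P(w[i..i+2k-1])=P(w[j..j+2k-1])$.
   Context: $w[a..b]$ denotes the fragment $w[a]w[a+1]\cdots w[b]$ of $w$ (positions numbered from $1$). A fragment is uniform if all its letters are equal. For a word $x$ over an ordered alphabet $\{0,\ldots,\sigma-1\}$, $P(x)=(|x|_0,\ldots,|x|_{\sigma-1})$ is its Parikh vector, where $|x|_c$ is the number of occurrences of $c$ in $x$. An Abelian square is a word $uv$ with $u,v$ nonempty, $|u|=|v|$ and $P(u)=P(v)$. -}

module Defs where

open import Data.Nat using (ℕ; zero; suc; _+_; _∸_; _≤_; _<_)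
open import Data.Fin using (Fin)
open import Data.Fin.Properties using (_≟_)
open import Data.List using (List; length; take; drop; filter)
open import Data.Vec using (Vec; tabulate)
import Data.Product
import Data.List
open import Data.Product using (_×_)
open import Data.List.Relation.Unary.All using (All)
open import Relation.Binary.PropositionalEquality using (_≡_)

Word : ℕ → Set
Word σ = List (Fin σ)

count : ∀ {σ} → Fin σ → Word σ → ℕ
count c x = length (filter (c ≟_) x)

parikh : ∀ {σ} → Word σ → Vec ℕ σ
parikh x = tabulate (λ c → count c x)

-- Fragment w[a..b] = w[a] w[a+1] ⋯ w[b], positions numbered from 1.
-- (Meaningful when 1 ≤ a and b ≤ |w|; we impose those bounds where used.)
frag : ∀ {σ} → Word σ → ℕ → ℕ → Word σ
frag w a b = take (suc b ∸ a) (drop (a ∸ 1) w)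

Uniform : ∀ {σ} → Word σ → Set
Uniform {σ} x = ∃Letter
  where
  ∃Letter : Set
  ∃Letter = Data.Product.Σ (Fin σ) (λ c → All (λ d → d ≡ c) x)

AbelianSquare : ∀ {σ} → Word σ → Set
AbelianSquare {σ} x = Data.Product.Σ (Word σ) λ u → Data.Product.Σ (Word σ) λ v →
  (x ≡ u Data.List.++ v) × (0 < length u) × (0 < length v) ×
  (length u ≡ length v) × (parikh u ≡ parikh v)

-- Fix a letter and measure positions from the first square, so the squares are w[0,2k) and
-- w[d,d+2k). Let A, C, u, E, G be the numbers of occurrences of the letter in w[0,k), w[d,d+k),
-- the gap w[k,k+d), w[0,d) and w[2k,2k+d). The squares contain 2A and 2C occurrences, and
-- counting in w[0,d+k) and w[0,d+2k) in two ways gives E + C = A + u and E + 2C = 2A + G,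
-- whence 2u = E + G. A uniform gap makes u equal to 0 or d, the extreme values of E and G,
-- so E = u and therefore C = A.
module Submission where

open import Defs
open import Data.Nat using (ℕ; zero; suc; _+_; _*_; _∸_; _≤_; _<_; _⊓_; ⌊_/2⌋; s<s⁻¹)
open import Data.Nat.Properties hiding (_≟_)
open import Data.Fin using (Fin)
open import Data.Fin.Properties using (_≟_)
open import Data.List using (List; []; _∷_; length; take; drop; filter; _++_)
open import Data.List.Properties
  using (∷-injective; length-++; length-take; length-drop; drop-drop; filter-++; filter-all; filter-none; length-filter)
import Data.List.Relation.Unary.All as All
open import Data.Vec using (lookup)
open import Data.Vec.Properties using (tabulate-cong; lookup∘tabulate)
open import Data.Product using (_×_; _,_)
open import Data.Sum using (_⊎_; inj₁; inj₂)
open import Relation.Nullary using (yes; no)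
open import Relation.Binary.PropositionalEquality
open import Data.Nat.Solver using (module +-*-Solver)
open import Algebra.Properties.CommutativeSemigroup +-commutativeSemigroup using (xy∙z≈xz∙y)

m+m≡n+n⇒m≡n : ∀ {m n} → m + m ≡ n + n → m ≡ n
m+m≡n+n⇒m≡n {m} {n} eq = trans (n≡⌊n+n/2⌋ m) (trans (cong ⌊_/2⌋ eq) (sym (n≡⌊n+n/2⌋ n)))

n≤m∧o≤m∧m+m≡n+o⇒n≡m : ∀ {m n o} → n ≤ m → o ≤ m → m + m ≡ n + o → n ≡ m
n≤m∧o≤m∧m+m≡n+o⇒n≡m {m} {n} n≤m o≤m eq =
  ≤-antisym n≤m (+-cancelʳ-≤ m m n (≤-trans (≤-reflexive eq) (+-monoʳ-≤ n o≤m)))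

square-count-balance : ∀ {A C E G u d} → E + C ≡ A + u → E + (C + C) ≡ (A + A) + G →
                       E ≤ d → G ≤ d → u ≡ d ⊎ u ≡ 0 → C ≡ A
square-count-balance {A} {C} {E} {G} {u} {d} e₁ e₂ E≤d G≤d u-extreme =
  +-cancelˡ-≡ E C A (trans e₁ (trans (cong (A +_) (sym (E≡u u-extreme))) (+-comm A E)))
  where
  open +-*-Solver
  open ≡-Reasoning
  u+u≡E+G : u + u ≡ E + G
  u+u≡E+G = +-cancelˡ-≡ (A + A) _ _ (begin
    (A + A) + (u + u) ≡⟨ solve 2 (λ A u → (A :+ A) :+ (u :+ u) := (A :+ u) :+ (A :+ u)) refl A u ⟩
    (A + u) + (A + u) ≡⟨ cong₂ _+_ e₁ e₁ ⟨
    (E + C) + (E + C) ≡⟨ solve 2 (λ E C → (E :+ C) :+ (E :+ C) := E :+ (E :+ (C :+ C))) refl E C ⟩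
    E + (E + (C + C)) ≡⟨ cong (E +_) e₂ ⟩
    E + ((A + A) + G) ≡⟨ solve 3 (λ E A G → E :+ ((A :+ A) :+ G) := (A :+ A) :+ (E :+ G)) refl E A G ⟩
    (A + A) + (E + G) ∎)
  E≡u : u ≡ d ⊎ u ≡ 0 → E ≡ u
  E≡u (inj₁ u≡d) =
    n≤m∧o≤m∧m+m≡n+o⇒n≡m (subst (E ≤_) (sym u≡d) E≤d) (subst (G ≤_) (sym u≡d) G≤d) u+u≡E+G
  E≡u (inj₂ u≡0) = trans (m+n≡0⇒m≡0 E (trans (sym u+u≡E+G) (cong₂ _+_ u≡0 u≡0))) (sym u≡0)

module _ {A : Set} where

  take-+ : ∀ m n (xs : List A) → take (m + n) xs ≡ take m xs ++ take n (drop m xs)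
  take-+ zero    n       xs       = refl
  take-+ (suc m) zero    []       = refl
  take-+ (suc m) (suc n) []       = refl
  take-+ (suc m) n       (x ∷ xs) = cong (x ∷_) (take-+ m n xs)

  ++-cancel-length : ∀ (xs ys us vs : List A) → length xs ≡ length us →
                     xs ++ ys ≡ us ++ vs → xs ≡ us × ys ≡ vs
  ++-cancel-length []       ys []       vs _   eq = refl , eq
  ++-cancel-length (x ∷ xs) ys (u ∷ us) vs len eq with ∷-injective eq
  ... | refl , eq′ with ++-cancel-length xs ys us vs (suc-injective len) eq′
  ... | refl , ys≡vs = refl , ys≡vs

module _ {σ : ℕ} where

  count-++ : ∀ (a : Fin σ) xs ys → count a (xs ++ ys) ≡ count a xs + count a ys
  count-++ a xs ys = trans (cong length (filter-++ (a ≟_) xs ys)) (length-++ (filter (a ≟_) xs))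

  count-parikh : ∀ (a : Fin σ) x y → parikh x ≡ parikh y → count a x ≡ count a y
  count-parikh a x y eq = begin
    count a x               ≡⟨ lookup∘tabulate (λ c → count c x) a ⟨
    lookup (parikh x) a     ≡⟨ cong (λ p → lookup p a) eq ⟩
    lookup (parikh y) a     ≡⟨ lookup∘tabulate (λ c → count c y) a ⟩
    count a y               ∎
    where open ≡-Reasoning

  count-uniform : ∀ (a : Fin σ) {xs} → Uniform xs → count a xs ≡ length xs ⊎ count a xs ≡ 0
  count-uniform a (c , all≡c) with a ≟ c
  ... | yes refl = inj₁ (cong length (filter-all (a ≟_) (All.map sym all≡c)))
  ... | no a≢c   =
    inj₂ (cong length (filter-none (a ≟_) (All.map (λ d≡c a≡d → a≢c (trans a≡d d≡c)) all≡c)))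

  abelianSquare-parikh : ∀ (xs ys : Word σ) → length xs ≡ length ys →
                         AbelianSquare (xs ++ ys) → parikh xs ≡ parikh ys
  abelianSquare-parikh xs ys |xs|≡|ys| (u , v , eq , _ , _ , |u|≡|v| , Pu≡Pv)
    with ++-cancel-length u v xs ys |u|≡|xs| (sym eq)
    where
    |u|≡|xs| : length u ≡ length xs
    |u|≡|xs| = m+m≡n+n⇒m≡n (begin
      length u + length u   ≡⟨ cong (length u +_) |u|≡|v| ⟩
      length u + length v   ≡⟨ length-++ u ⟨
      length (u ++ v)       ≡⟨ cong length eq ⟨
      length (xs ++ ys)     ≡⟨ length-++ xs ⟩
      length xs + length ys ≡⟨ cong (length xs +_) |xs|≡|ys| ⟨
      length xs + length xs ∎)
      where open ≡-Reasoning
  ... | refl , refl = Pu≡Pv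

  window : Word σ → ℕ → ℕ → Word σ
  window w n m = take m (drop n w)

  frag-window : ∀ (w : Word σ) n m → frag w (suc n) (n + m) ≡ window w n m
  frag-window w n m = cong (λ l → take l (drop n w)) (m+n∸m≡n n m)

  window-+ : ∀ (w : Word σ) n m l → window w n (m + l) ≡ window w n m ++ window w (n + m) l
  window-+ w n m l =
    trans (take-+ m l (drop n w)) (cong (λ v → window w n m ++ take l v) (drop-drop n m w))

  length-window : ∀ (w : Word σ) n m → n + m ≤ length w → length (window w n m) ≡ m
  length-window w n m n+m≤|w| = begin
    length (take m (drop n w))   ≡⟨ length-take m (drop n w) ⟩
    m ⊓ length (drop n w)        ≡⟨ m≤n⇒m⊓n≡m (subst (m ≤_) (sym (length-drop n w)) m≤|w|∸n) ⟩
    m                            ∎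
    where
    open ≡-Reasoning
    m≤|w|∸n : m ≤ length w ∸ n
    m≤|w|∸n = m+n≤o⇒m≤o∸n m (subst (_≤ length w) (+-comm n m) n+m≤|w|)

  count-window-≤ : ∀ (a : Fin σ) w n m → count a (window w n m) ≤ m
  count-window-≤ a w n m = begin
    count a (take m (drop n w)) ≤⟨ length-filter (a ≟_) (take m (drop n w)) ⟩
    length (take m (drop n w))  ≡⟨ length-take m (drop n w) ⟩
    m ⊓ length (drop n w)       ≤⟨ m⊓n≤m m _ ⟩
    m                           ∎
    where open ≤-Reasoning

  count-window-+ : ∀ (a : Fin σ) w n m l →
    count a (window w n (m + l)) ≡ count a (window w n m) + count a (window w (n + m) l)
  count-window-+ a w n m l = trans (cong (count a) (window-+ w n m l)) (count-++ a (window w n m) _)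

  count-uniform-window : ∀ (a : Fin σ) w p d → p + d ≤ length w → Uniform (window w p d) →
                         count a (window w p d) ≡ d ⊎ count a (window w p d) ≡ 0
  count-uniform-window a w p d fits uniform with count-uniform a uniform
  ... | inj₁ full = inj₁ (trans full (length-window w p d fits))
  ... | inj₂ none = inj₂ none

  count-abelianSquare-window : ∀ (a : Fin σ) w p k → p + (k + k) ≤ length w →
    AbelianSquare (window w p (k + k)) →
    count a (window w p (k + k)) ≡ count a (window w p k) + count a (window w p k)
  count-abelianSquare-window a w p k fits square = begin
    count a (window w p (k + k))                          ≡⟨ count-window-+ a w p k k ⟩
    count a (window w p k) + count a (window w (p + k) k) ≡⟨ cong (count a (window w p k) +_) halves ⟨
    count a (window w p k) + count a (window w p k)       ∎
    where
    open ≡-Reasoning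
    fits′ : p + k + k ≤ length w
    fits′ = subst (_≤ length w) (sym (+-assoc p k k)) fits
    same-length : length (window w p k) ≡ length (window w (p + k) k)
    same-length = trans (length-window w p k (m+n≤o⇒m≤o (p + k) fits′))
                        (sym (length-window w (p + k) k fits′))
    halves : count a (window w p k) ≡ count a (window w (p + k) k)
    halves = count-parikh a (window w p k) (window w (p + k) k)
      (abelianSquare-parikh (window w p k) (window w (p + k) k) same-length
        (subst AbelianSquare (window-+ w p k k) square))

  parikh-abelianSquares-uniform-gap : ∀ (w : Word σ) k n d → n + d + (k + k) ≤ length w →
    AbelianSquare (window w n (k + k)) → AbelianSquare (window w (n + d) (k + k)) →
    Uniform (window w (n + k) d) →
    parikh (window w n (k + k)) ≡ parikh (window w (n + d) (k + k))
  parikh-abelianSquares-uniform-gap w k n d fits square₁ square₂ uniform = tabulate-cong same-count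
    where
    same-count : ∀ a → count a (window w n (k + k)) ≡ count a (window w (n + d) (k + k))
    same-count a = begin
      occ n (k + k)                 ≡⟨ count-abelianSquare-window a w n k fits₁ square₁ ⟩
      occ n k + occ n k             ≡⟨ cong₂ _+_ C≡A C≡A ⟨
      occ (n + d) k + occ (n + d) k ≡⟨ count-abelianSquare-window a w (n + d) k fits square₂ ⟨
      occ (n + d) (k + k)           ∎
      where
      open ≡-Reasoning
      occ : ℕ → ℕ → ℕ
      occ p m = count a (window w p m)
      fits₁ : n + (k + k) ≤ length w
      fits₁ = ≤-trans (+-monoˡ-≤ (k + k) (m≤m+n n d)) fits
      gap-fits : n + k + d ≤ length w
      gap-fits = ≤-trans (≤-reflexive (xy∙z≈xz∙y n k d))
                         (≤-trans (+-monoʳ-≤ (n + d) (m≤m+n k k)) fits)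
      split₁ : occ n d + occ (n + d) k ≡ occ n k + occ (n + k) d
      split₁ = begin
        occ n d + occ (n + d) k ≡⟨ count-window-+ a w n d k ⟨
        occ n (d + k)           ≡⟨ cong (occ n) (+-comm d k) ⟩
        occ n (k + d)           ≡⟨ count-window-+ a w n k d ⟩
        occ n k + occ (n + k) d ∎
      split₂ : occ n d + (occ (n + d) k + occ (n + d) k) ≡ (occ n k + occ n k) + occ (n + (k + k)) d
      split₂ = begin
        occ n d + (occ (n + d) k + occ (n + d) k)
          ≡⟨ cong (occ n d +_) (count-abelianSquare-window a w (n + d) k fits square₂) ⟨
        occ n d + occ (n + d) (k + k)             ≡⟨ count-window-+ a w n d (k + k) ⟨
        occ n (d + (k + k))                       ≡⟨ cong (occ n) (+-comm d (k + k)) ⟩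
        occ n ((k + k) + d)                       ≡⟨ count-window-+ a w n (k + k) d ⟩
        occ n (k + k) + occ (n + (k + k)) d
          ≡⟨ cong (_+ occ (n + (k + k)) d) (count-abelianSquare-window a w n k fits₁ square₁) ⟩
        (occ n k + occ n k) + occ (n + (k + k)) d ∎
      C≡A : occ (n + d) k ≡ occ n k
      C≡A = square-count-balance split₁ split₂
              (count-window-≤ a w n d) (count-window-≤ a w (n + (k + k)) d)
              (count-uniform-window a w (n + k) d gap-fits uniform)

lemma13 : ∀ {σ} (w : Word σ) (k i j : ℕ) →
    1 ≤ k → 1 ≤ i → i < j → j + 2 * k ∸ 1 ≤ length w →
    AbelianSquare (frag w i (i + 2 * k ∸ 1)) →
    AbelianSquare (frag w j (j + 2 * k ∸ 1)) →
    Uniform (frag w (i + k) (j + k ∸ 1)) →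
    parikh (frag w i (i + 2 * k ∸ 1)) ≡ parikh (frag w j (j + 2 * k ∸ 1))
lemma13 w k (suc n) (suc j) _ _ i<j fits square₁ square₂ uniform
  with d , refl ← m≤n⇒∃[o]m+o≡n (<⇒≤ (s<s⁻¹ i<j))
  rewrite frag-window w n (2 * k) | frag-window w (n + d) (2 * k) | +-identityʳ k
  = parikh-abelianSquares-uniform-gap w k n d fits square₁ square₂ uniform′
  where
  uniform′ : Uniform (window w (n + k) d)
  uniform′ = subst Uniform
    (trans (cong (frag w (suc (n + k))) (xy∙z≈xz∙y n d k)) (frag-window w (n + k) d)) uniform
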